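{- The following four identities hold: \[ \sum_{n\geq 1} q^n (q^n;q)_\infty (-q^{n+1};q)_{\infty}^2(q^{3};q^3)_{n-1} = \frac{(q^2;q^2)_\infty}{(q;q^2)_\infty} - (q^3;q^3)_\infty, \] \[ \sum_{n\geq 1} q^n (q^n;q)_\infty (q^{n+1};q)_{\infty}^2(q^{3};q^3)_{n-1} = \frac{1}{3} \big( (q^3;q^3)_\infty -(q;q)_\infty^3 \big), \] \[ \sum_{n\geq 1}q^n (-q^n;q)_\infty (-q^{n+1};q)_{\infty}^2(-q^{3};q^3)_{n-1} = \frac{1}{3} \big( (-q;q)_\infty^3-(-q^3;q^3)_\infty \big), \] \[ \sum_{n\geq 1}q^n (-q^n;q)_\infty (q^{n+1};q)_{\infty}^2(-q^{3};q^3)_{n-1} = (-q^3;q^3)_\infty -(-q;q)_\infty(q;q)_\infty^2. \]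
   Context: $q$ is a complex number with $|q|<1$. $(a;q)_0=1$, $(a;q)_n=\prod_{j=0}^{n-1}(1-aq^j)$, $(a;q)_\infty=\prod_{j\ge0}(1-aq^j)$. -}

module Defs where

-- The identities of the paper are identities of
-- convergent power series for |q| < 1, hence equivalent to identities of
-- formal power series in ℤ[[q]] (both sides are holomorphic on the unit disc).

open import Data.Nat using (ℕ; zero; suc; _∸_)
import Data.Nat as ℕ
open import Data.Integer using (ℤ; +_; -_; _+_; _*_; _-_)
open import Data.List using (List; []; _∷_; lookup; length)
open import Data.Bool using (if_then_else_)
open import Relation.Binary.PropositionalEquality using (_≡_)

Series : Set
Series = ℕ → ℤ

Σ< : ℕ → (ℕ → ℤ) → ℤ
Σ< zero    f = + 0
Σ< (suc n) f = Σ< n f + f n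

𝟘 𝟙 : Series
𝟘 _ = + 0
𝟙 zero    = + 1
𝟙 (suc _) = + 0

const : ℤ → Series
const c zero    = c
const c (suc _) = + 0

qpow : ℕ → Series
qpow m N = if N ℕ.≡ᵇ m then + 1 else + 0

infixl 6 _⊕_ _⊖_
infixl 7 _⊗_ _·_

_⊕_ : Series → Series → Series
(f ⊕ g) N = f N + g N

_⊖_ : Series → Series → Series
(f ⊖ g) N = f N - g N

_·_ : ℤ → Series → Series
(c · f) N = c * f N

_⊗_ : Series → Series → Series
(f ⊗ g) N = Σ< (suc N) (λ k → f k * g (N ∸ k))

sq : Series → Series
sq f = f ⊗ f

cube : Series → Series
cube f = f ⊗ f ⊗ f

prodTo : ℕ → (ℕ → Series) → Series
prodTo zero    F = 𝟙
prodTo (suc n) F = prodTo n F ⊗ F n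

sumTo : ℕ → (ℕ → Series) → Series
sumTo zero    F = 𝟘
sumTo (suc n) F = sumTo n F ⊕ F n

-- Infinite product ∏_{j ≥ 0} F j in the q-adic topology, for families with
-- F j ≡ 1 (mod q^{j+1}): the coefficient of q^N is that of ∏_{j ≤ N} F j.
∏∞ : (ℕ → Series) → Series
∏∞ F N = prodTo (suc N) F N

-- Infinite sum Σ_{j ≥ 0} T j in the q-adic topology, for families with
-- T j ≡ 0 (mod q^{j}) : the coefficient of q^N is that of Σ_{j ≤ N} T j.
Σ∞ : (ℕ → Series) → Series
Σ∞ T N = sumTo (suc N) T N

-- q-Pochhammer symbols with base c·q^a (c ∈ ℤ) and nome q^b:
-- (c q^a ; q^b)_m  =  ∏_{j < m} (1 - c q^{a + b j})
poch : ℤ → ℕ → ℕ → ℕ → Series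
poch c a b m = prodTo m (λ j → 𝟙 ⊖ c · qpow (a ℕ.+ b ℕ.* j))

-- (c q^a ; q^b)_∞  =  ∏_{j ≥ 0} (1 - c q^{a + b j}), used with a ≥ 1, b ≥ 1
poch∞ : ℤ → ℕ → ℕ → Series
poch∞ c a b = ∏∞ (λ j → 𝟙 ⊖ c · qpow (a ℕ.+ b ℕ.* j))

-- multiplicative inverse of a series with constant term 1:
-- g 0 = 1,  g N = - Σ_{k=1}^{N} f k * g (N - k).
-- invList f N = [g N, g (N-1), …, g 0]
private
  invList : Series → ℕ → List ℤ
  invList f zero    = + 1 ∷ []
  invList f (suc N) = (- Σ< (suc N) (λ k → f (suc k) * nth k prev)) ∷ prev
    where
    prev = invList f N
    nth : ℕ → List ℤ → ℤ
    nth _       []       = + 0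
    nth zero    (x ∷ _)  = x
    nth (suc k) (_ ∷ xs) = nth k xs

inv : Series → Series
inv f N with invList f N
... | x ∷ _ = x
... | []    = + 0

infix 4 _≋_
_≋_ : Series → Series → Set
f ≋ g = ∀ N → f N ≡ g N

{-# OPTIONS --safe #-}
-- Write a_m = (c₁q^{m+1};q)_∞ (c₂q^{m+1};q)_∞² (c₃q³;q³)_m and x = q^{m+1}.  Peeling the first
-- factor off each infinite product gives
--   a_{m+1} - a_m = (c₁q^{m+2};q)_∞ (c₂q^{m+2};q)_∞² (c₃q³;q³)_m ((1 - c₃x³) - (1 - c₁x)(1 - c₂x)²),
-- and for the four sign patterns (c₁,c₂,c₃) of the theorem the polynomial in brackets is
-- κ x (1 - c₁x) with κ = -1, 3, -3, 1.  So κ times each sum telescopes to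
-- (c₃q³;q³)_∞ - (c₁q;q)_∞ (c₂q;q)_∞², since a_m → (c₃q³;q³)_∞ q-adically.  In the first identity
-- Euler's (-q;q)_∞ = 1/(q;q²)_∞ turns (q;q)_∞ (-q;q)_∞² into (q²;q²)_∞ / (q;q²)_∞.
module Submission where

open import Defs
open import Data.Nat using (ℕ; zero; suc; _∸_; _≤_; _<_; z≤n; s≤s)
import Data.Nat as ℕ
import Data.Nat.Properties as ℕP
open import Data.Nat.Tactic.RingSolver using (solve-∀)
open import Data.Integer using (ℤ; +_; -_; _+_; _*_; _-_)
import Data.Integer as ℤ
import Data.Integer.Properties as ℤP
import Data.Integer.Solver as ℤS
open import Data.Product using (_×_; _,_)
open import Data.Sum using (inj₁; inj₂)
open import Data.Maybe using (Maybe; just; nothing)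
open import Function using (_∘_)
open import Relation.Nullary using (yes; no)
open import Relation.Binary.PropositionalEquality
open import Relation.Binary.Bundles using (Setoid)
import Relation.Binary.Reasoning.Setoid as SetoidReasoning
open import Algebra.Structures using (IsCommutativeMonoid)
open import Algebra.Structures.Biased using (isCommutativeSemiringˡ)
open import Algebra.Solver.Ring.AlmostCommutativeRing
import Algebra.Solver.Ring

-- Finite sums

Σ<-cong : ∀ n {f g : ℕ → ℤ} → (∀ k → k < n → f k ≡ g k) → Σ< n f ≡ Σ< n g
Σ<-cong zero    eq = refl
Σ<-cong (suc n) eq =
  cong₂ _+_ (Σ<-cong n (λ k k<n → eq k (ℕP.m<n⇒m<1+n k<n))) (eq n ℕP.≤-refl)

Σ<-suc : ∀ n (f : ℕ → ℤ) → Σ< (suc n) f ≡ f 0 + Σ< n (f ∘ suc)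
Σ<-suc zero    f = trans (ℤP.+-identityˡ (f 0)) (sym (ℤP.+-identityʳ (f 0)))
Σ<-suc (suc n) f =
  trans (cong (_+ f (suc n)) (Σ<-suc n f)) (ℤP.+-assoc (f 0) (Σ< n (f ∘ suc)) (f (suc n)))

Σ<-+ : ∀ n (f g : ℕ → ℤ) → Σ< n (λ k → f k + g k) ≡ Σ< n f + Σ< n g
Σ<-+ zero    f g = refl
Σ<-+ (suc n) f g rewrite Σ<-+ n f g =
  solve 4 (λ a b c d → (a :+ b) :+ (c :+ d) := (a :+ c) :+ (b :+ d)) refl
    (Σ< n f) (Σ< n g) (f n) (g n)
  where open ℤS.+-*-Solver

Σ<-* : ∀ n c (f : ℕ → ℤ) → Σ< n (λ k → c * f k) ≡ c * Σ< n f
Σ<-* zero    c f = sym (ℤP.*-zeroʳ c)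
Σ<-* (suc n) c f rewrite Σ<-* n c f = sym (ℤP.*-distribˡ-+ c (Σ< n f) (f n))

Σ<-zero : ∀ n (f : ℕ → ℤ) → (∀ k → f k ≡ + 0) → Σ< n f ≡ + 0
Σ<-zero zero    f eq = refl
Σ<-zero (suc n) f eq rewrite Σ<-zero n f eq | eq n = refl

Σ<-reverse : ∀ n (f : ℕ → ℤ) → Σ< n f ≡ Σ< n (λ k → f (n ∸ suc k))
Σ<-reverse zero    f = refl
Σ<-reverse (suc n) f = trans (cong (_+ f n) (Σ<-reverse n f))
  (trans (ℤP.+-comm _ (f n)) (sym (Σ<-suc n (λ k → f (suc n ∸ suc k)))))

-- The ring of formal power series

≋-refl : ∀ {f} → f ≋ f
≋-refl N = refl

≋-sym : ∀ {f g} → f ≋ g → g ≋ f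
≋-sym p N = sym (p N)

≋-trans : ∀ {f g h} → f ≋ g → g ≋ h → f ≋ h
≋-trans p q N = trans (p N) (q N)

≡⇒≋ : ∀ {f g} → f ≡ g → f ≋ g
≡⇒≋ = cong-app

≋-setoid : Setoid _ _
≋-setoid = record
  { Carrier = Series ; _≈_ = _≋_
  ; isEquivalence = record { refl = ≋-refl ; sym = ≋-sym ; trans = ≋-trans } }

neg : Series → Series
neg f N = - f N

⊕-cong : ∀ {f f′ g g′} → f ≋ f′ → g ≋ g′ → f ⊕ g ≋ f′ ⊕ g′
⊕-cong p q N = cong₂ _+_ (p N) (q N)

⊖-cong : ∀ {f f′ g g′} → f ≋ f′ → g ≋ g′ → f ⊖ g ≋ f′ ⊖ g′
⊖-cong p q N = cong₂ _-_ (p N) (q N)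

neg-cong : ∀ {f f′} → f ≋ f′ → neg f ≋ neg f′
neg-cong p N = cong -_ (p N)

·-identityˡ : ∀ f → + 1 · f ≋ f
·-identityˡ f N = ℤP.*-identityˡ (f N)

·-negate : ∀ {κ f g h} → κ · f ≋ g ⊖ h → (- κ) · f ≋ h ⊖ g
·-negate {κ} {f} {g} {h} p N = trans (sym (ℤP.neg-distribˡ-* κ (f N)))
  (trans (cong -_ (p N)) (solve 2 (λ a b → :- (a :- b) := b :- a) refl (g N) (h N)))
  where open ℤS.+-*-Solver

⊗-zero : ∀ f g → (f ⊗ g) 0 ≡ f 0 * g 0
⊗-zero f g = ℤP.+-identityˡ _

⊗-suc : ∀ f g n → (f ⊗ g) (suc n) ≡ f 0 * g (suc n) + ((f ∘ suc) ⊗ g) n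
⊗-suc f g n = Σ<-suc (suc n) (λ k → f k * g (suc n ∸ k))

⊗-cong : ∀ {f f′ g g′} → f ≋ f′ → g ≋ g′ → f ⊗ g ≋ f′ ⊗ g′
⊗-cong p q N = Σ<-cong (suc N) λ k _ → cong₂ _*_ (p k) (q (N ∸ k))

⊗-congˡ : ∀ {f f′} g → f ≋ f′ → f ⊗ g ≋ f′ ⊗ g
⊗-congˡ g p = ⊗-cong p (≋-refl {g})

⊗-congʳ : ∀ f {g g′} → g ≋ g′ → f ⊗ g ≋ f ⊗ g′
⊗-congʳ f p = ⊗-cong (≋-refl {f}) p

⊗-comm : ∀ f g → f ⊗ g ≋ g ⊗ f
⊗-comm f g N = trans (Σ<-reverse (suc N) _) (Σ<-cong (suc N) λ k k≤N →
  trans (cong (λ i → f (N ∸ k) * g i) (ℕP.m∸[m∸n]≡n (ℕP.≤-pred k≤N)))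
        (ℤP.*-comm (f (N ∸ k)) (g k)))

⊗-distribʳ : ∀ f g h → (f ⊕ g) ⊗ h ≋ f ⊗ h ⊕ g ⊗ h
⊗-distribʳ f g h N =
  trans (Σ<-cong (suc N) (λ k _ → ℤP.*-distribʳ-+ (h (N ∸ k)) (f k) (g k))) (Σ<-+ (suc N) _ _)

·-⊗ : ∀ c f g → (c · f) ⊗ g ≋ c · (f ⊗ g)
·-⊗ c f g N =
  trans (Σ<-cong (suc N) (λ k _ → ℤP.*-assoc c (f k) (g (N ∸ k)))) (Σ<-* (suc N) c _)

neg-⊗ : ∀ f g → neg f ⊗ g ≋ neg (f ⊗ g)
neg-⊗ f g N = begin
  (neg f ⊗ g) N                          ≡⟨ Σ<-cong (suc N) (λ k _ → neg-as-product k) ⟩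
  Σ< (suc N) (λ k → - + 1 * (f k * g (N ∸ k))) ≡⟨ Σ<-* (suc N) (- + 1) _ ⟩
  - + 1 * (f ⊗ g) N                      ≡⟨ ℤP.-1*i≡-i _ ⟩
  neg (f ⊗ g) N                          ∎
  where
  open ≡-Reasoning
  neg-as-product : ∀ k → - f k * g (N ∸ k) ≡ - + 1 * (f k * g (N ∸ k))
  neg-as-product k = trans (sym (ℤP.neg-distribˡ-* (f k) (g (N ∸ k)))) (sym (ℤP.-1*i≡-i _))

𝟘-⊗ : ∀ f → 𝟘 ⊗ f ≋ 𝟘
𝟘-⊗ f N = Σ<-zero (suc N) _ (λ k → refl)

𝟙-⊗ : ∀ f → 𝟙 ⊗ f ≋ f
𝟙-⊗ f zero    = trans (⊗-zero 𝟙 f) (ℤP.*-identityˡ _)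
𝟙-⊗ f (suc n) = trans (⊗-suc 𝟙 f n)
  (trans (cong₂ _+_ (ℤP.*-identityˡ (f (suc n))) (𝟘-⊗ f n)) (ℤP.+-identityʳ (f (suc n))))

⊗-identityʳ : ∀ f → f ⊗ 𝟙 ≋ f
⊗-identityʳ f = ≋-trans (⊗-comm f 𝟙) (𝟙-⊗ f)

⊗-assoc : ∀ f g h → (f ⊗ g) ⊗ h ≋ f ⊗ (g ⊗ h)
⊗-assoc f g h zero = begin
  ((f ⊗ g) ⊗ h) 0    ≡⟨ trans (⊗-zero (f ⊗ g) h) (cong (_* h 0) (⊗-zero f g)) ⟩
  f 0 * g 0 * h 0     ≡⟨ ℤP.*-assoc (f 0) (g 0) (h 0) ⟩
  f 0 * (g 0 * h 0)   ≡⟨ sym (trans (⊗-zero f (g ⊗ h)) (cong (f 0 *_) (⊗-zero g h))) ⟩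
  (f ⊗ (g ⊗ h)) 0    ∎
  where open ≡-Reasoning
⊗-assoc f g h (suc n) = begin
  ((f ⊗ g) ⊗ h) (suc n)
    ≡⟨ ⊗-suc (f ⊗ g) h n ⟩
  (f ⊗ g) 0 * h (suc n) + (((f ⊗ g) ∘ suc) ⊗ h) n
    ≡⟨ cong₂ _+_ (cong (_* h (suc n)) (⊗-zero f g)) (⊗-congˡ h (⊗-suc f g) n) ⟩
  f 0 * g 0 * h (suc n) + ((f 0 · (g ∘ suc) ⊕ (f ∘ suc) ⊗ g) ⊗ h) n
    ≡⟨ cong (_+_ (f 0 * g 0 * h (suc n)))
         (⊗-distribʳ (f 0 · (g ∘ suc)) ((f ∘ suc) ⊗ g) h n) ⟩
  f 0 * g 0 * h (suc n) + (((f 0 · (g ∘ suc)) ⊗ h) n + (((f ∘ suc) ⊗ g) ⊗ h) n)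
    ≡⟨ cong (_+_ (f 0 * g 0 * h (suc n)))
         (cong₂ _+_ (·-⊗ (f 0) (g ∘ suc) h n) (⊗-assoc (f ∘ suc) g h n)) ⟩
  f 0 * g 0 * h (suc n) + (f 0 * ((g ∘ suc) ⊗ h) n + ((f ∘ suc) ⊗ (g ⊗ h)) n)
    ≡⟨ solve 5 (λ a b c d e → a :* b :* c :+ (a :* d :+ e) := a :* (b :* c :+ d) :+ e) refl
         (f 0) (g 0) (h (suc n)) (((g ∘ suc) ⊗ h) n) (((f ∘ suc) ⊗ (g ⊗ h)) n) ⟩
  f 0 * (g 0 * h (suc n) + ((g ∘ suc) ⊗ h) n) + ((f ∘ suc) ⊗ (g ⊗ h)) n
    ≡⟨ cong (λ z → f 0 * z + ((f ∘ suc) ⊗ (g ⊗ h)) n) (sym (⊗-suc g h n)) ⟩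
  f 0 * (g ⊗ h) (suc n) + ((f ∘ suc) ⊗ (g ⊗ h)) n
    ≡⟨ sym (⊗-suc f (g ⊗ h) n) ⟩
  (f ⊗ (g ⊗ h)) (suc n) ∎
  where
  open ≡-Reasoning
  open ℤS.+-*-Solver

⊕-isCommutativeMonoid : IsCommutativeMonoid _≋_ _⊕_ 𝟘
⊕-isCommutativeMonoid = record
  { isMonoid = record
    { isSemigroup = record
      { isMagma = record { isEquivalence = Setoid.isEquivalence ≋-setoid ; ∙-cong = ⊕-cong }
      ; assoc = λ f g h N → ℤP.+-assoc (f N) (g N) (h N) }
    ; identity = (λ f N → ℤP.+-identityˡ (f N)) , (λ f N → ℤP.+-identityʳ (f N)) }
  ; comm = λ f g N → ℤP.+-comm (f N) (g N) }

⊗-isCommutativeMonoid : IsCommutativeMonoid _≋_ _⊗_ 𝟙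
⊗-isCommutativeMonoid = record
  { isMonoid = record
    { isSemigroup = record
      { isMagma = record { isEquivalence = Setoid.isEquivalence ≋-setoid ; ∙-cong = ⊗-cong }
      ; assoc = ⊗-assoc }
    ; identity = 𝟙-⊗ , ⊗-identityʳ }
  ; comm = ⊗-comm }

series-ring : AlmostCommutativeRing _ _
series-ring = record
  { Carrier = Series ; _≈_ = _≋_ ; _+_ = _⊕_ ; _*_ = _⊗_ ; -_ = neg ; 0# = 𝟘 ; 1# = 𝟙
  ; isAlmostCommutativeRing = record
    { isCommutativeSemiring = isCommutativeSemiringˡ record
      { +-isCommutativeMonoid = ⊕-isCommutativeMonoid
      ; *-isCommutativeMonoid = ⊗-isCommutativeMonoid
      ; distribʳ = λ h f g → ⊗-distribʳ f g h
      ; zeroˡ = 𝟘-⊗ }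
    ; -‿cong = neg-cong
    ; -‿*-distribˡ = neg-⊗
    ; -‿+-comm = λ f g N → sym (ℤP.neg-distrib-+ (f N) (g N)) } }

const⊗≋· : ∀ c f → const c ⊗ f ≋ c · f
const⊗≋· c f zero    = ⊗-zero (const c) f
const⊗≋· c f (suc n) = trans (⊗-suc (const c) f n)
  (trans (cong (_+_ (c * f (suc n))) (𝟘-⊗ f n)) (ℤP.+-identityʳ _))

·-const : ∀ a b → a · const b ≋ const (a * b)
·-const a b zero    = refl
·-const a b (suc n) = ℤP.*-zeroʳ a

const-homomorphism : ℤ.+-*-rawRing -Raw-AlmostCommutative⟶ series-ring
const-homomorphism = record
  { ⟦_⟧ = const
  ; +-homo = λ { a b zero → refl ; a b (suc n) → refl }
  ; *-homo = λ a b → ≋-sym (≋-trans (const⊗≋· a (const b)) (·-const a b))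
  ; -‿homo = λ { a zero → refl ; a (suc n) → refl }
  ; 0-homo = λ { zero → refl ; (suc n) → refl }
  ; 1-homo = λ { zero → refl ; (suc n) → refl } }

const-≟ : ∀ a b → Maybe (const a ≋ const b)
const-≟ a b with a ℤP.≟ b
... | yes refl = just ≋-refl
... | no _     = nothing

module ⊗-Solver = Algebra.Solver.Ring ℤ.+-*-rawRing series-ring const-homomorphism const-≟

-- Agreement of coefficients below a given order

infix 4 _≈[_]_
_≈[_]_ : Series → ℕ → Series → Set
f ≈[ K ] g = ∀ N → N < K → f N ≡ g N

≈-refl : ∀ {K f} → f ≈[ K ] f
≈-refl N _ = refl

≈-sym : ∀ {K f g} → f ≈[ K ] g → g ≈[ K ] f
≈-sym p N N<K = sym (p N N<K)

≈-trans : ∀ {K f g h} → f ≈[ K ] g → g ≈[ K ] h → f ≈[ K ] h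
≈-trans p q N N<K = trans (p N N<K) (q N N<K)

≋⇒≈ : ∀ {K f g} → f ≋ g → f ≈[ K ] g
≋⇒≈ p N _ = p N

≈-weaken : ∀ {K L f g} → L ≤ K → f ≈[ K ] g → f ≈[ L ] g
≈-weaken L≤K p N N<L = p N (ℕP.<-≤-trans N<L L≤K)

≈⇒≋ : ∀ {f g} → (∀ N → f ≈[ suc N ] g) → f ≋ g
≈⇒≋ p N = p N N ℕP.≤-refl

⊗-cong≈ : ∀ {K f f′ g g′} → f ≈[ K ] f′ → g ≈[ K ] g′ → f ⊗ g ≈[ K ] f′ ⊗ g′
⊗-cong≈ {K} p q N N<K = Σ<-cong (suc N) λ k k≤N →
  cong₂ _*_ (p k (ℕP.≤-<-trans (ℕP.≤-pred k≤N) N<K))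
            (q (N ∸ k) (ℕP.≤-<-trans (ℕP.m∸n≤m N k) N<K))

⊗-identity≈ʳ : ∀ {K} f {g} → g ≈[ K ] 𝟙 → f ⊗ g ≈[ K ] f
⊗-identity≈ʳ f g≈𝟙 = ≈-trans (⊗-cong≈ (≈-refl {f = f}) g≈𝟙) (≋⇒≈ (⊗-identityʳ f))

qpow-zero : qpow 0 ≋ 𝟙
qpow-zero zero    = refl
qpow-zero (suc N) = refl

qpow-below : ∀ e N → N < e → qpow e N ≡ + 0
qpow-below (suc e) zero    _         = refl
qpow-below (suc e) (suc N) (s≤s N<e) = qpow-below e N N<e

qpow-+ : ∀ a b → qpow a ⊗ qpow b ≋ qpow (a ℕ.+ b)
qpow-+ zero    b         = ≋-trans (⊗-congˡ (qpow b) qpow-zero) (𝟙-⊗ (qpow b))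
qpow-+ (suc a) b zero    = ⊗-zero (qpow (suc a)) (qpow b)
qpow-+ (suc a) b (suc n) =
  trans (⊗-suc (qpow (suc a)) (qpow b) n) (trans (ℤP.+-identityˡ _) (qpow-+ a b n))

qpow-cube : ∀ e → cube (qpow e) ≋ qpow (3 ℕ.* e)
qpow-cube e = ≋-trans (⊗-congˡ (qpow e) (qpow-+ e e))
  (≋-trans (qpow-+ (e ℕ.+ e) e) (≡⇒≋ (cong qpow (idx e))))
  where
  idx : ∀ e → e ℕ.+ e ℕ.+ e ≡ 3 ℕ.* e
  idx = solve-∀

𝟙⊖qpow≈𝟙 : ∀ c e → 𝟙 ⊖ c · qpow e ≈[ e ] 𝟙
𝟙⊖qpow≈𝟙 c e N N<e rewrite qpow-below e N N<e | ℤP.*-zeroʳ c = ℤP.+-identityʳ (𝟙 N)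

-- 1 - c x, in the form the ring solver produces (unlike 𝟙 ⊖ c · x in Defs)
factor : ℤ → Series → Series
factor c x = const (+ 1) ⊖ const c ⊗ x

𝟙⊖·≋factor : ∀ c x → 𝟙 ⊖ c · x ≋ factor c x
𝟙⊖·≋factor c x N = cong₂ _-_ (𝟙≋const N) (sym (const⊗≋· c x N))
  where
  𝟙≋const : 𝟙 ≋ const (+ 1)
  𝟙≋const zero    = refl
  𝟙≋const (suc N) = refl

factor-cong : ∀ c {x y} → x ≋ y → factor c x ≋ factor c y
factor-cong c x≋y = ⊖-cong (≋-refl {const (+ 1)}) (⊗-congʳ (const c) x≋y)

-- Finite and infinite products

prodTo-cong : ∀ n {F G : ℕ → Series} → (∀ j → F j ≋ G j) → prodTo n F ≋ prodTo n G
prodTo-cong zero    p = ≋-refl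
prodTo-cong (suc n) p = ⊗-cong (prodTo-cong n p) (p n)

prodTo-suc : ∀ n (F : ℕ → Series) → prodTo (suc n) F ≋ F 0 ⊗ prodTo n (F ∘ suc)
prodTo-suc zero    F = ≋-trans (𝟙-⊗ (F 0)) (≋-sym (⊗-identityʳ (F 0)))
prodTo-suc (suc n) F = ≋-trans (⊗-congˡ (F (suc n)) (prodTo-suc n F))
  (⊗-assoc (F 0) (prodTo n (F ∘ suc)) (F (suc n)))

prodTo-⊗ : ∀ n (F G : ℕ → Series) → prodTo n F ⊗ prodTo n G ≋ prodTo n (λ j → F j ⊗ G j)
prodTo-⊗ zero    F G = 𝟙-⊗ 𝟙
prodTo-⊗ (suc n) F G = ≋-trans
  (solve 4 (λ a b c d → (a :* c) :* (b :* d) := (a :* b) :* (c :* d)) ≋-refl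
     (prodTo n F) (prodTo n G) (F n) (G n))
  (⊗-congˡ (F n ⊗ G n) (prodTo-⊗ n F G))
  where open ⊗-Solver

prodTo-interleave : ∀ n (F : ℕ → Series) →
  prodTo (2 ℕ.* n) F ≋ prodTo n (λ j → F (2 ℕ.* j)) ⊗ prodTo n (λ j → F (suc (2 ℕ.* j)))
prodTo-interleave zero    F = ≋-sym (𝟙-⊗ 𝟙)
prodTo-interleave (suc n) F = ≋-trans (≡⇒≋ (cong (λ k → prodTo k F) (ℕP.*-suc 2 n))) (≋-trans
  (⊗-congˡ (F (suc (2 ℕ.* n))) (⊗-congˡ (F (2 ℕ.* n)) (prodTo-interleave n F)))
  (solve 4 (λ a b c d → a :* b :* c :* d := (a :* c) :* (b :* d)) ≋-refl
     (prodTo n (λ j → F (2 ℕ.* j))) (prodTo n (λ j → F (suc (2 ℕ.* j))))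
     (F (2 ℕ.* n)) (F (suc (2 ℕ.* n)))))
  where open ⊗-Solver

prodTo≈𝟙 : ∀ {K} n (F : ℕ → Series) → (∀ j → F j ≈[ K ] 𝟙) → prodTo n F ≈[ K ] 𝟙
prodTo≈𝟙 zero    F p = ≈-refl
prodTo≈𝟙 (suc n) F p = ≈-trans (⊗-identity≈ʳ (prodTo n F) (p n)) (prodTo≈𝟙 n F p)

-- F j ≡ 1 (mod q^{j+1}): the families for which ∏∞ F is the q-adic limit of prodTo n F.
Admissible : (ℕ → Series) → Set
Admissible F = ∀ j → F j ≈[ suc j ] 𝟙

admissible-∘ : ∀ {F} (σ : ℕ → ℕ) → (∀ j → j ≤ σ j) → Admissible F → Admissible (F ∘ σ)
admissible-∘ σ j≤σj adm j = ≈-weaken (s≤s (j≤σj j)) (adm (σ j))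

admissible-⊗ : ∀ {F G} → Admissible F → Admissible G → Admissible (λ j → F j ⊗ G j)
admissible-⊗ {F} admF admG j =
  ≈-trans (⊗-identity≈ʳ (F j) (admG j)) (admF j)

prodTo-stable : ∀ {F} → Admissible F → ∀ {K} M → K ≤ M → prodTo M F ≈[ K ] prodTo K F
prodTo-stable adm zero    z≤n = ≈-refl
prodTo-stable adm (suc M) K≤1+M with ℕP.m≤n⇒m<n∨m≡n K≤1+M
... | inj₂ refl        = ≈-refl
... | inj₁ (s≤s K≤M) = ≈-trans (⊗-identity≈ʳ _ (≈-weaken (ℕP.m≤n⇒m≤1+n K≤M) (adm M)))
                                (prodTo-stable adm M K≤M)

∏∞≈prodTo : ∀ {F} → Admissible F → ∀ {K} M → K ≤ M → ∏∞ F ≈[ K ] prodTo M F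
∏∞≈prodTo adm M K≤M N N<K = sym (prodTo-stable adm M (ℕP.≤-trans N<K K≤M) N ℕP.≤-refl)

∏∞≈𝟙 : ∀ {K} (F : ℕ → Series) → (∀ j → F j ≈[ K ] 𝟙) → ∏∞ F ≈[ K ] 𝟙
∏∞≈𝟙 F p N = prodTo≈𝟙 (suc N) F p N

∏∞-cong : ∀ {F G} → (∀ j → F j ≋ G j) → ∏∞ F ≋ ∏∞ G
∏∞-cong p N = prodTo-cong (suc N) p N

∏∞-⊗ : ∀ {F G} → Admissible F → Admissible G → ∏∞ F ⊗ ∏∞ G ≋ ∏∞ (λ j → F j ⊗ G j)
∏∞-⊗ {F} {G} admF admG = ≈⇒≋ λ N →
  ≈-trans (⊗-cong≈ (∏∞≈prodTo admF (suc N) ℕP.≤-refl) (∏∞≈prodTo admG (suc N) ℕP.≤-refl))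
  (≈-trans (≋⇒≈ (prodTo-⊗ (suc N) F G))
  (≈-sym (∏∞≈prodTo (admissible-⊗ admF admG) (suc N) ℕP.≤-refl)))

∏∞-suc : ∀ {F} → Admissible F → ∏∞ F ≋ F 0 ⊗ ∏∞ (F ∘ suc)
∏∞-suc {F} adm = ≈⇒≋ λ N →
  ≈-trans (∏∞≈prodTo adm (suc (suc N)) (ℕP.n≤1+n (suc N)))
  (≈-trans (≋⇒≈ (prodTo-suc (suc N) F))
  (⊗-cong≈ (≈-refl {f = F 0})
    (≈-sym (∏∞≈prodTo (admissible-∘ suc ℕP.n≤1+n adm) (suc N) ℕP.≤-refl))))

∏∞-interleave : ∀ {F} → Admissible F →
  ∏∞ F ≋ ∏∞ (λ j → F (2 ℕ.* j)) ⊗ ∏∞ (λ j → F (suc (2 ℕ.* j)))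
∏∞-interleave {F} adm = ≈⇒≋ λ N →
  ≈-trans (∏∞≈prodTo adm (2 ℕ.* suc N) (ℕP.m≤n*m (suc N) 2))
  (≈-trans (≋⇒≈ (prodTo-interleave (suc N) F))
  (⊗-cong≈ (≈-sym (∏∞≈prodTo adm-even (suc N) ℕP.≤-refl))
           (≈-sym (∏∞≈prodTo adm-odd (suc N) ℕP.≤-refl))))
  where
  adm-even = admissible-∘ (2 ℕ.*_) (λ j → ℕP.m≤n*m j 2) adm
  adm-odd  = admissible-∘ (λ j → suc (2 ℕ.* j)) (λ j → ℕP.m≤n⇒m≤1+n (ℕP.m≤n*m j 2)) adm

-- q-Pochhammer symbols

pochFactor : ℤ → ℕ → ℕ → ℕ → Series
pochFactor c a b j = 𝟙 ⊖ c · qpow (a ℕ.+ b ℕ.* j)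

pochFactor-admissible : ∀ c a b → Admissible (pochFactor c (suc a) (suc b))
pochFactor-admissible c a b j = ≈-weaken (s≤s j≤a+[j+bj]) (𝟙⊖qpow≈𝟙 c (suc a ℕ.+ suc b ℕ.* j))
  where j≤a+[j+bj] = ℕP.≤-trans (ℕP.m≤m+n j (b ℕ.* j)) (ℕP.m≤n+m (j ℕ.+ b ℕ.* j) a)

poch∞≈𝟙 : ∀ c a b → poch∞ c a b ≈[ a ] 𝟙
poch∞≈𝟙 c a b = ∏∞≈𝟙 (pochFactor c a b) λ j →
  ≈-weaken (ℕP.m≤m+n a (b ℕ.* j)) (𝟙⊖qpow≈𝟙 c (a ℕ.+ b ℕ.* j))

pochFactor-cong : ∀ c {e e′} → e ≡ e′ → 𝟙 ⊖ c · qpow e ≋ 𝟙 ⊖ c · qpow e′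
pochFactor-cong c e≡e′ = ≡⇒≋ (cong (λ e → 𝟙 ⊖ c · qpow e) e≡e′)

poch∞-suc : ∀ c a b →
  poch∞ c (suc a) (suc b) ≋ (𝟙 ⊖ c · qpow (suc a)) ⊗ poch∞ c (suc b ℕ.+ suc a) (suc b)
poch∞-suc c a b = ≋-trans (∏∞-suc (pochFactor-admissible c a b))
  (⊗-cong (pochFactor-cong c (idx₀ a b)) (∏∞-cong λ j → pochFactor-cong c (idx a b j)))
  where
  idx₀ : ∀ a b → suc a ℕ.+ suc b ℕ.* 0 ≡ suc a
  idx₀ = solve-∀
  idx : ∀ a b j → suc a ℕ.+ suc b ℕ.* suc j ≡ (suc b ℕ.+ suc a) ℕ.+ suc b ℕ.* j
  idx = solve-∀

poch∞-split : ∀ c a b → poch∞ c (suc a) (suc b) ≋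
  poch∞ c (suc a) (2 ℕ.* suc b) ⊗ poch∞ c (suc b ℕ.+ suc a) (2 ℕ.* suc b)
poch∞-split c a b = ≋-trans (∏∞-interleave (pochFactor-admissible c a b))
  (⊗-cong (∏∞-cong λ j → pochFactor-cong c (idx-even a b j))
          (∏∞-cong λ j → pochFactor-cong c (idx-odd a b j)))
  where
  idx-even : ∀ a b j → suc a ℕ.+ suc b ℕ.* (2 ℕ.* j) ≡ suc a ℕ.+ 2 ℕ.* suc b ℕ.* j
  idx-even = solve-∀
  idx-odd : ∀ a b j →
    suc a ℕ.+ suc b ℕ.* suc (2 ℕ.* j) ≡ (suc b ℕ.+ suc a) ℕ.+ 2 ℕ.* suc b ℕ.* j
  idx-odd = solve-∀

poch∞-⊗-neg : ∀ a b → poch∞ (+ 1) (suc a) (suc b) ⊗ poch∞ (- + 1) (suc a) (suc b)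
                      ≋ poch∞ (+ 1) (2 ℕ.* suc a) (2 ℕ.* suc b)
poch∞-⊗-neg a b = ≋-trans
  (∏∞-⊗ (pochFactor-admissible (+ 1) a b) (pochFactor-admissible (- + 1) a b))
  (∏∞-cong factor-identity)
  where
  open SetoidReasoning ≋-setoid
  idx : ∀ a b j → (suc a ℕ.+ suc b ℕ.* j) ℕ.+ (suc a ℕ.+ suc b ℕ.* j)
                  ≡ 2 ℕ.* suc a ℕ.+ 2 ℕ.* suc b ℕ.* j
  idx = solve-∀
  factor-identity : ∀ j →
    pochFactor (+ 1) (suc a) (suc b) j ⊗ pochFactor (- + 1) (suc a) (suc b) j
    ≋ pochFactor (+ 1) (2 ℕ.* suc a) (2 ℕ.* suc b) j
  factor-identity j = begin
    (𝟙 ⊖ + 1 · y) ⊗ (𝟙 ⊖ - + 1 · y)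
      ≈⟨ ⊗-cong (𝟙⊖·≋factor (+ 1) y) (𝟙⊖·≋factor (- + 1) y) ⟩
    factor (+ 1) y ⊗ factor (- + 1) y
      ≈⟨ solve 1 (λ y → (con (+ 1) :- con (+ 1) :* y) :* (con (+ 1) :- con (- + 1) :* y)
                        := con (+ 1) :- con (+ 1) :* (y :* y)) ≋-refl y ⟩
    factor (+ 1) (y ⊗ y)
      ≈⟨ factor-cong (+ 1) (≋-trans (qpow-+ e e) (≡⇒≋ (cong qpow (idx a b j)))) ⟩
    factor (+ 1) (qpow e′)
      ≈⟨ ≋-sym (𝟙⊖·≋factor (+ 1) (qpow e′)) ⟩
    𝟙 ⊖ + 1 · qpow e′ ∎
    where
    open ⊗-Solver using (solve; _:=_; con; _:-_; _:*_)
    e = suc a ℕ.+ suc b ℕ.* j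
    e′ = 2 ℕ.* suc a ℕ.+ 2 ℕ.* suc b ℕ.* j
    y = qpow e

-- Inverses and Euler's identity

module _ (f : Series) where
  -- inv is computed through a private list; H abstracts the lookup into that list.
  private
    inv-suc′ : (H : ℕ → ℕ → ℤ)
      → (∀ N → inv f (suc N) ≡ - Σ< (suc N) (λ k → f (suc k) * H N k))
      → (∀ N → H N 0 ≡ inv f N)
      → (∀ N k → H (suc N) (suc k) ≡ H N k)
      → ∀ N → inv f (suc N) ≡ - ((f ∘ suc) ⊗ inv f) N
    inv-suc′ H inv-def H-head H-suc N = trans (inv-def N)
      (cong -_ (Σ<-cong (suc N) λ k k≤N → cong (f (suc k) *_) (H≡inv N k (ℕP.≤-pred k≤N))))
      where
      H≡inv : ∀ N k → k ≤ N → H N k ≡ inv f (N ∸ k)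
      H≡inv N       zero    _         = H-head N
      H≡inv (suc N) (suc k) (s≤s k≤N) = trans (H-suc N k) (H≡inv N k k≤N)

  inv-suc : ∀ N → inv f (suc N) ≡ - ((f ∘ suc) ⊗ inv f) N
  inv-suc = inv-suc′ _ (λ N → refl) (λ { zero → refl ; (suc N) → refl }) (λ N k → refl)

  ⊗-inverseʳ : f 0 ≡ + 1 → f ⊗ inv f ≋ 𝟙
  ⊗-inverseʳ f₀≡1 zero    = trans (⊗-zero f (inv f)) (cong (_* + 1) f₀≡1)
  ⊗-inverseʳ f₀≡1 (suc N) = begin
    (f ⊗ inv f) (suc N)            ≡⟨ ⊗-suc f (inv f) N ⟩
    f 0 * inv f (suc N) + rest     ≡⟨ cong (λ c → c * inv f (suc N) + rest) f₀≡1 ⟩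
    + 1 * inv f (suc N) + rest     ≡⟨ cong (_+ rest) (trans (ℤP.*-identityˡ _) (inv-suc N)) ⟩
    - rest + rest                  ≡⟨ ℤP.+-inverseˡ rest ⟩
    + 0                            ∎
    where
    open ≡-Reasoning
    rest = ((f ∘ suc) ⊗ inv f) N

⊗-cancelʳ : ∀ {f g} h → h 0 ≡ + 1 → f ⊗ h ≋ g ⊗ h → f ≋ g
⊗-cancelʳ {f} {g} h h₀≡1 fh≋gh = begin
  f                  ≈⟨ ≋-sym (cancel f) ⟩
  f ⊗ (h ⊗ inv h)    ≈⟨ ≋-sym (⊗-assoc f h (inv h)) ⟩
  f ⊗ h ⊗ inv h      ≈⟨ ⊗-congˡ (inv h) fh≋gh ⟩
  g ⊗ h ⊗ inv h      ≈⟨ ⊗-assoc g h (inv h) ⟩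
  g ⊗ (h ⊗ inv h)    ≈⟨ cancel g ⟩
  g                  ∎
  where
  open SetoidReasoning ≋-setoid
  cancel : ∀ u → u ⊗ (h ⊗ inv h) ≋ u
  cancel u = ≋-trans (⊗-congʳ u (⊗-inverseʳ h h₀≡1)) (⊗-identityʳ u)

-- Cancel (q²;q²)_∞ from (-q;q)_∞ (q;q²)_∞ (q²;q²)_∞ = (-q;q)_∞ (q;q)_∞ = (q²;q²)_∞.
euler : poch∞ (- + 1) 1 1 ≋ inv (poch∞ (+ 1) 1 2)
euler = ⊗-cancelʳ O refl
  (≋-trans M⊗O≋𝟙 (≋-sym (≋-trans (⊗-comm (inv O) O) (⊗-inverseʳ O refl))))
  where
  open SetoidReasoning ≋-setoid
  P M O E : Series
  P = poch∞ (+ 1) 1 1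
  M = poch∞ (- + 1) 1 1
  O = poch∞ (+ 1) 1 2
  E = poch∞ (+ 1) 2 2
  M⊗O≋𝟙 : M ⊗ O ≋ 𝟙
  M⊗O≋𝟙 = ⊗-cancelʳ E refl (begin
    M ⊗ O ⊗ E     ≈⟨ ⊗-assoc M O E ⟩
    M ⊗ (O ⊗ E)   ≈⟨ ⊗-congʳ M (≋-sym (poch∞-split (+ 1) 0 0)) ⟩
    M ⊗ P         ≈⟨ ⊗-comm M P ⟩
    P ⊗ M         ≈⟨ poch∞-⊗-neg 0 0 ⟩
    E             ≈⟨ ≋-sym (𝟙-⊗ E) ⟩
    𝟙 ⊗ E         ∎)

-- Telescoping

·-sumTo : ∀ c n (T : ℕ → Series) → c · sumTo n T ≋ sumTo n (λ m → c · T m)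
·-sumTo c zero    T N = ℤP.*-zeroʳ c
·-sumTo c (suc n) T N =
  trans (ℤP.*-distribˡ-+ c (sumTo n T N) (T n N)) (cong (_+ c * T n N) (·-sumTo c n T N))

·-Σ∞ : ∀ c (T : ℕ → Series) → c · Σ∞ T ≋ Σ∞ (λ m → c · T m)
·-Σ∞ c T N = ·-sumTo c (suc N) T N

sumTo-telescope : ∀ {D a : ℕ → Series} → (∀ m → D m ≋ a (suc m) ⊖ a m) →
  ∀ n → sumTo n D ≋ a n ⊖ a 0
sumTo-telescope {a = a} step zero    N = sym (ℤP.+-inverseʳ (a 0 N))
sumTo-telescope {a = a} step (suc n) N =
  trans (cong₂ _+_ (sumTo-telescope {a = a} step n N) (step n N))
  (solve 3 (λ x y z → (x :- y) :+ (z :- x) := z :- y) refl (a n N) (a 0 N) (a (suc n) N))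
  where open ℤS.+-*-Solver

Σ∞-telescope : ∀ {D a : ℕ → Series} {L} → (∀ m → D m ≋ a (suc m) ⊖ a m) →
  (∀ n → a n ≈[ n ] L) → Σ∞ D ≋ L ⊖ a 0
Σ∞-telescope {a = a} step a→L N =
  trans (sumTo-telescope {a = a} step (suc N) N) (cong (_- a 0 N) (a→L (suc N) N ℕP.≤-refl))

TelescopeStep : ℤ → ℤ → ℤ → ℤ → Set
TelescopeStep c₁ c₂ c₃ κ =
  ∀ x → factor c₃ (cube x) ⊖ factor c₁ x ⊗ sq (factor c₂ x) ≋ const κ ⊗ (x ⊗ factor c₁ x)

module Telescope (c₁ c₂ c₃ κ : ℤ) (step : TelescopeStep c₁ c₂ c₃ κ) where

  term partial : ℕ → Series
  term m = qpow (suc m) ⊗ poch∞ c₁ (suc m) 1 ⊗ sq (poch∞ c₂ (suc (suc m)) 1) ⊗ poch c₃ 3 3 m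
  partial m = poch∞ c₁ (suc m) 1 ⊗ sq (poch∞ c₂ (suc m) 1) ⊗ poch c₃ 3 3 m

  partial-step : ∀ m → κ · term m ≋ partial (suc m) ⊖ partial m
  partial-step m = begin
    κ · term m
      ≈⟨ ≋-sym (const⊗≋· κ (term m)) ⟩
    const κ ⊗ term m
      ≈⟨ ⊗-congʳ (const κ) (⊗-congˡ R (⊗-congˡ (sq B) (⊗-congʳ x (peel c₁)))) ⟩
    const κ ⊗ (x ⊗ (y₁ ⊗ A) ⊗ sq B ⊗ R)
      ≈⟨ solve 6 (λ k x y₁ A B R → k :* (x :* (y₁ :* A) :* (B :* B) :* R)
                                   := A :* (B :* B) :* R :* (k :* (x :* y₁)))
               ≋-refl (const κ) x y₁ A B R ⟩
    A ⊗ sq B ⊗ R ⊗ (const κ ⊗ (x ⊗ y₁))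
      ≈⟨ ⊗-congʳ (A ⊗ sq B ⊗ R) (≋-sym (step x)) ⟩
    A ⊗ sq B ⊗ R ⊗ (y₃ ⊖ y₁ ⊗ sq y₂)
      ≈⟨ solve 6 (λ y₁ y₂ y₃ A B R →
                    A :* (B :* B) :* R :* (y₃ :- y₁ :* (y₂ :* y₂))
                    := A :* (B :* B) :* (R :* y₃) :- (y₁ :* A) :* ((y₂ :* B) :* (y₂ :* B)) :* R)
               ≋-refl y₁ y₂ y₃ A B R ⟩
    A ⊗ sq B ⊗ (R ⊗ y₃) ⊖ (y₁ ⊗ A) ⊗ sq (y₂ ⊗ B) ⊗ R
      ≈⟨ ⊖-cong (⊗-congʳ (A ⊗ sq B) (⊗-congʳ R (≋-sym last-factor)))
                (≋-sym (⊗-congˡ R (⊗-cong (peel c₁) (⊗-cong (peel c₂) (peel c₂))))) ⟩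
    partial (suc m) ⊖ partial m ∎
    where
    open SetoidReasoning ≋-setoid
    open ⊗-Solver using (solve; _:=_; _:-_; _:*_)
    x A B R y₁ y₂ y₃ : Series
    x = qpow (suc m)
    A = poch∞ c₁ (suc (suc m)) 1
    B = poch∞ c₂ (suc (suc m)) 1
    R = poch c₃ 3 3 m
    y₁ = factor c₁ x
    y₂ = factor c₂ x
    y₃ = factor c₃ (cube x)
    peel : ∀ c → poch∞ c (suc m) 1 ≋ factor c x ⊗ poch∞ c (suc (suc m)) 1
    peel c = ≋-trans (poch∞-suc c m 0) (⊗-congˡ (poch∞ c (suc (suc m)) 1) (𝟙⊖·≋factor c x))
    last-factor : 𝟙 ⊖ c₃ · qpow (3 ℕ.+ 3 ℕ.* m) ≋ y₃
    last-factor = ≋-trans (𝟙⊖·≋factor c₃ _)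
      (factor-cong c₃ (≋-trans (≡⇒≋ (cong qpow (sym (ℕP.*-suc 3 m))))
                               (≋-sym (qpow-cube (suc m)))))

  partial→poch∞ : ∀ n → partial n ≈[ n ] poch∞ c₃ 3 3
  partial→poch∞ n = ≈-trans
    (⊗-cong≈ (⊗-cong≈ (tail≈𝟙 c₁) (⊗-cong≈ (tail≈𝟙 c₂) (tail≈𝟙 c₂)))
             (≈-sym (∏∞≈prodTo (pochFactor-admissible c₃ 2 2) n ℕP.≤-refl)))
    (≋⇒≈ (≋-trans (⊗-congˡ (poch∞ c₃ 3 3) (≋-trans (𝟙-⊗ (𝟙 ⊗ 𝟙)) (𝟙-⊗ 𝟙)))
                  (𝟙-⊗ (poch∞ c₃ 3 3))))
    where
    tail≈𝟙 : ∀ c → poch∞ c (suc n) 1 ≈[ n ] 𝟙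
    tail≈𝟙 c = ≈-weaken (ℕP.n≤1+n n) (poch∞≈𝟙 c (suc n) 1)

  scaled-sum : κ · Σ∞ term ≋ poch∞ c₃ 3 3 ⊖ poch∞ c₁ 1 1 ⊗ sq (poch∞ c₂ 1 1)
  scaled-sum = ≋-trans (·-Σ∞ κ term)
    (≋-trans (Σ∞-telescope {a = partial} partial-step partial→poch∞)
             (⊖-cong (≋-refl {poch∞ c₃ 3 3}) (⊗-identityʳ (poch∞ c₁ 1 1 ⊗ sq (poch∞ c₂ 1 1)))))

  scaled-sum-negated : (- κ) · Σ∞ term ≋ poch∞ c₁ 1 1 ⊗ sq (poch∞ c₂ 1 1) ⊖ poch∞ c₃ 3 3
  scaled-sum-negated =
    ·-negate {κ} {Σ∞ term} {poch∞ c₃ 3 3} {poch∞ c₁ 1 1 ⊗ sq (poch∞ c₂ 1 1)} scaled-sum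

module _ where
  open ⊗-Solver using (solve; _:=_; _:-_; _:*_; con; Polynomial)

  private
    factorᴾ : ℤ → Polynomial 1 → Polynomial 1
    factorᴾ c x = con (+ 1) :- con c :* x

    stepᴾ : ℤ → ℤ → ℤ → ℤ → Polynomial 1 → Polynomial 1 × Polynomial 1
    stepᴾ c₁ c₂ c₃ κ x =
      factorᴾ c₃ (x :* x :* x) :- factorᴾ c₁ x :* (factorᴾ c₂ x :* factorᴾ c₂ x)
      := con κ :* (x :* factorᴾ c₁ x)

  telescopeStep₁ : TelescopeStep (+ 1) (- + 1) (+ 1) (- + 1)
  telescopeStep₁ = solve 1 (stepᴾ (+ 1) (- + 1) (+ 1) (- + 1)) ≋-refl

  telescopeStep₂ : TelescopeStep (+ 1) (+ 1) (+ 1) (+ 3)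
  telescopeStep₂ = solve 1 (stepᴾ (+ 1) (+ 1) (+ 1) (+ 3)) ≋-refl

  telescopeStep₃ : TelescopeStep (- + 1) (- + 1) (- + 1) (- + 3)
  telescopeStep₃ = solve 1 (stepᴾ (- + 1) (- + 1) (- + 1) (- + 3)) ≋-refl

  telescopeStep₄ : TelescopeStep (- + 1) (+ 1) (- + 1) (+ 1)
  telescopeStep₄ = solve 1 (stepᴾ (- + 1) (+ 1) (- + 1) (+ 1)) ≋-refl

theorem2p1 :
    (Σ∞ (λ m → qpow (suc m) ⊗ poch∞ (+ 1) (suc m) 1
                 ⊗ sq (poch∞ (- + 1) (suc (suc m)) 1) ⊗ poch (+ 1) 3 3 m)
       ≋ poch∞ (+ 1) 2 2 ⊗ inv (poch∞ (+ 1) 1 2) ⊖ poch∞ (+ 1) 3 3)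
    × (+ 3 · Σ∞ (λ m → qpow (suc m) ⊗ poch∞ (+ 1) (suc m) 1
                 ⊗ sq (poch∞ (+ 1) (suc (suc m)) 1) ⊗ poch (+ 1) 3 3 m)
       ≋ poch∞ (+ 1) 3 3 ⊖ cube (poch∞ (+ 1) 1 1))
    × (+ 3 · Σ∞ (λ m → qpow (suc m) ⊗ poch∞ (- + 1) (suc m) 1
                 ⊗ sq (poch∞ (- + 1) (suc (suc m)) 1) ⊗ poch (- + 1) 3 3 m)
       ≋ cube (poch∞ (- + 1) 1 1) ⊖ poch∞ (- + 1) 3 3)
    × (Σ∞ (λ m → qpow (suc m) ⊗ poch∞ (- + 1) (suc m) 1
                 ⊗ sq (poch∞ (+ 1) (suc (suc m)) 1) ⊗ poch (- + 1) 3 3 m)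
       ≋ poch∞ (- + 1) 3 3 ⊖ poch∞ (- + 1) 1 1 ⊗ sq (poch∞ (+ 1) 1 1))
theorem2p1 =
    ≋-trans (≋-sym (·-identityˡ _))
      (≋-trans T₁.scaled-sum-negated (⊖-cong P⊗M²≋E/O (≋-refl {poch∞ (+ 1) 3 3})))
  , ≋-trans T₂.scaled-sum (⊖-cong (≋-refl {poch∞ (+ 1) 3 3}) (⊗-sq≋cube P))
  , ≋-trans T₃.scaled-sum-negated (⊖-cong (⊗-sq≋cube M) (≋-refl {poch∞ (- + 1) 3 3}))
  , ≋-trans (≋-sym (·-identityˡ _)) T₄.scaled-sum
  where
  module T₁ = Telescope (+ 1) (- + 1) (+ 1) (- + 1) telescopeStep₁
  module T₂ = Telescope (+ 1) (+ 1) (+ 1) (+ 3) telescopeStep₂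
  module T₃ = Telescope (- + 1) (- + 1) (- + 1) (- + 3) telescopeStep₃
  module T₄ = Telescope (- + 1) (+ 1) (- + 1) (+ 1) telescopeStep₄
  P M : Series
  P = poch∞ (+ 1) 1 1
  M = poch∞ (- + 1) 1 1
  ⊗-sq≋cube : ∀ f → f ⊗ sq f ≋ cube f
  ⊗-sq≋cube f = ≋-sym (⊗-assoc f f f)
  P⊗M²≋E/O : P ⊗ sq M ≋ poch∞ (+ 1) 2 2 ⊗ inv (poch∞ (+ 1) 1 2)
  P⊗M²≋E/O = ≋-trans (≋-sym (⊗-assoc P M M)) (⊗-cong (poch∞-⊗-neg 0 0) euler)
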